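{- Let $\alpha/\!/\beta$ be a skew composition of size $n$, let $i\in[n-1]$, let $E\in\mathcal E(\alpha/\!/\beta)$ and let $T_1,T_2\in E$ with $T_1\preceq T_2$. Then $i\in\operatorname{supp}(\mathrm{col}_{T_2}\mathrm{col}_{T_1}^{ -1})$ if and only if the shape of $T_2^{>i}$ differs from the shape of $T_1^{>i}$.
   Context: $\mathfrak S_n$ is the symmetric group on $[n]$, $s_i=(i,i+1)$, products are composition of functions. A reduced word of $\sigma$ is an expression $\sigma=s_{j_k}\cdots s_{j_1}$ with $k$ minimal; $\operatorname{supp}(\sigma)$ is the set of $i$ such that $s_i$ occurs in a reduced word of $\sigma$ (equivalently in every one). $H_n(0)$ is generated by $\pi_1,\dots,\pi_{n-1}$ with $\pi_i^2=\pi_i$, $\pi_i\pi_{i+1}\pi_i=\pi_{i+1}\pi_i\pi_{i+1}$, $\pi_i\pi_j=\pi_j\pi_i$ ($|i-j|\ge2$); $\pi_\sigma=\pi_{j_k}\cdots\pi_{j_1}$ for a reduced word $s_{j_k}\cdots s_{j_1}$. Compositions, diagrams (matrix coordinates, row 1 on top); composition poset $\mathcal L_c$: $\beta\lessdot_c\alpha$ iff $\alpha=(1,\beta_1,\dots,\beta_l)$ or $\alpha$ is obtained from $\beta$ by increasing $\beta_k$ by one where $\beta_i\ne\beta_k$ for all $i<k$. For $\beta\le_c\alpha$ the diagrams of $\beta$ and intermediate compositions are placed at the bottom of $\alpha$; $\alpha/\!/\beta$ is the set of cells of $\alpha$ not in $\beta$. An SCT of shape $\alpha/\!/\beta$ and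 size $n=|\alpha|-|\beta|$ is a bijection $T:\alpha/\!/\beta\to[n]$ with rows decreasing left to right, first column increasing top to bottom, and the triple rule: with $T=\infty$ on cells of $\beta$, if $(j,k)\in\alpha/\!/\beta$, $(i,k-1)\in\alpha$, $j>i$, $T(j,k)<T(i,k-1)$, then $(i,k)\in\alpha$ and $T(j,k)<T(i,k)$. SCTs of shape $\alpha/\!/\beta$ correspond to saturated chains $\beta=\alpha^n\lessdot_c\cdots\lessdot_c\alpha^0=\alpha$ via $\alpha^n=\beta$, $\alpha^{k-1}=\alpha^k\cup T^{ -1}(k)$; $T^{>m}$ is the SCT of shape $\alpha^m/\!/\beta$ corresponding to $\alpha^n\lessdot_c\cdots\lessdot_c\alpha^m$. With $c_T(k)$ the column of $T^{ -1}(k)$ and cell $(i,j)$ attacking $(i',j')$ iff ($j=j'$, $i\ne i'$) or ($j=j'-1$, $i<i'$): $D(T)=\{i:c_T(i)\le c_T(i+1)\}$, $AD(T)=\{i\in D(T):T^{ -1}(i)\text{ attacks }T^{ -1}(i+1)\}$, $nAD(T)=D(T)\setminus AD(T)$; $\pi_iT=T$ if $i\notin D(T)$, $0$ if $i\in AD(T)$, and $T$ with entries $i,i+1$ interchanged if $i\in nAD(T)$. $T_1\sim T_2$ iff in each column the relative orders of entries coincide; $\mathcal E(\alpha/\!/\beta)$ is the set of classes; on $E$, $T_1\preceq T_2$ iff $\pi_\sigma T_1=T_2$ for some $\sigma\in\mathfrak S_n$. The column word $\mathrm{col}_T$ reads columns left to right, each top to bottom, as a permutation in one-line notation. -}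

module Defs where

open import Data.Nat using (ℕ; zero; suc; _+_; _∸_; _≤_; _<_; _≤ᵇ_; _<ᵇ_; _≡ᵇ_; _⊔_)
open import Data.Bool using (Bool; true; false; if_then_else_; _∧_; _∨_; not)
open import Data.List using (List; []; _∷_; length; map; concatMap; upTo; lookup; updateAt; foldr)
open import Data.List.Relation.Unary.All using (All)
open import Data.List.Membership.Propositional using (_∈_)
open import Data.Nat.ListAction using (sum)
open import Data.Fin using (Fin; toℕ)
open import Data.Maybe using (Maybe; just; nothing)
open import Data.Product using (_×_; _,_; ∃; proj₁; proj₂)
open import Data.Sum using (_⊎_)
open import Data.Empty using (⊥)
open import Relation.Nullary using (¬_)
open import Relation.Binary.PropositionalEquality using (_≡_; _≢_)
open import Relation.Binary.Construct.Closure.ReflexiveTransitive using (Star)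

IsComposition : List ℕ → Set
IsComposition α = All (λ x → 1 ≤ x) α

data _⋖c_ : List ℕ → List ℕ → Set where
  prepend : ∀ β → β ⋖c (1 ∷ β)
  bump    : ∀ β (k : Fin (length β)) →
            (∀ (j : Fin (length β)) → toℕ j < toℕ k → lookup β j ≢ lookup β k) →
            β ⋖c updateAt β k suc

_≤c_ : List ℕ → List ℕ → Set
β ≤c α = Star _⋖c_ β α

size : List ℕ → List ℕ → ℕ
size α β = sum α ∸ sum β

-- Cells (matrix coordinates: (row , column), rows and columns from 1,
-- row 1 on top).  β is placed at the bottom of α.

Cell : Set
Cell = ℕ × ℕ

row col : Cell → ℕ
row = proj₁
col = proj₂

-- 1-indexed row length (0 outside)
rowLen : List ℕ → ℕ → ℕ
rowLen []       _             = 0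
rowLen (x ∷ xs) zero          = 0
rowLen (x ∷ xs) (suc zero)    = x
rowLen (x ∷ xs) (suc (suc r)) = rowLen xs (suc r)

maxPart : List ℕ → ℕ
maxPart = foldr _⊔_ 0

inαᵇ : List ℕ → Cell → Bool
inαᵇ α (r , c) = (1 ≤ᵇ c) ∧ (c ≤ᵇ rowLen α r)

inβᵇ : List ℕ → List ℕ → Cell → Bool
inβᵇ α β (r , c) =
  let d = length α ∸ length β in
  (d <ᵇ r) ∧ ((1 ≤ᵇ c) ∧ (c ≤ᵇ rowLen β (r ∸ d)))

inSkewᵇ : List ℕ → List ℕ → Cell → Bool
inSkewᵇ α β c = inαᵇ α c ∧ not (inβᵇ α β c)

filterᵇ' : {A : Set} → (A → Bool) → List A → List A
filterᵇ' p []       = []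
filterᵇ' p (x ∷ xs) = if p x then x ∷ filterᵇ' p xs else filterᵇ' p xs

oneTo : ℕ → List ℕ
oneTo m = map suc (upTo m)

skewCells : List ℕ → List ℕ → List Cell
skewCells α β =
  concatMap (λ c → filterᵇ' (inSkewᵇ α β) (map (λ r → (r , c)) (oneTo (length α))))
            (oneTo (maxPart α))

-- a filling assigns a natural number to every cell; only the values on
-- the cells of α//β are relevant
Filling : Set
Filling = Cell → ℕ

-- "x < T̂(c)" where T̂ = T on α//β and T̂ = ∞ on cells of β
LtHat : List ℕ → List ℕ → Filling → ℕ → Cell → Set
LtHat α β T x c = (inβᵇ α β c ≡ true) ⊎ (x < T c)

record SCT (α β : List ℕ) (T : Filling) : Set where
  field
    range   : ∀ c → c ∈ skewCells α β → 1 ≤ T c × T c ≤ size α β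
    inj     : ∀ c c' → c ∈ skewCells α β → c' ∈ skewCells α β → T c ≡ T c' → c ≡ c'
    surj    : ∀ k → 1 ≤ k → k ≤ size α β → ∃ λ c → c ∈ skewCells α β × T c ≡ k
    rowsDec : ∀ r c c' → (r , c) ∈ skewCells α β → (r , c') ∈ skewCells α β →
              c < c' → T (r , c') < T (r , c)
    col1Inc : ∀ r r' → (r , 1) ∈ skewCells α β → (r' , 1) ∈ skewCells α β →
              r < r' → T (r , 1) < T (r' , 1)
    triple  : ∀ j i k' → (j , suc k') ∈ skewCells α β → inαᵇ α (i , k') ≡ true →
              i < j → LtHat α β T (T (j , suc k')) (i , k') →
              (inαᵇ α (i , suc k') ≡ true) × LtHat α β T (T (j , suc k')) (i , suc k')

locate : List Cell → Filling → ℕ → Maybe Cell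
locate []       T k = nothing
locate (c ∷ cs) T k = if T c ≡ᵇ k then just c else locate cs T k

attacksᵇ : Cell → Cell → Bool
attacksᵇ (r , c) (r' , c') = ((c ≡ᵇ c') ∧ not (r ≡ᵇ r')) ∨ ((suc c ≡ᵇ c') ∧ (r <ᵇ r'))

swapEntries : ℕ → Filling → Filling
swapEntries i T x = if T x ≡ᵇ i then suc i else (if T x ≡ᵇ suc i then i else T x)

-- π_i T  (nothing represents 0)
πgen : List ℕ → List ℕ → ℕ → Filling → Maybe Filling
πgen α β i T with locate (skewCells α β) T i | locate (skewCells α β) T (suc i)
... | just c₁ | just c₂ =
  if col c₁ ≤ᵇ col c₂
  then (if attacksᵇ c₁ c₂ then nothing
        else just (swapEntries i T))
  else just T
... | _ | _ = just T

-- π_{j_k} ⋯ π_{j_1} applied to T, for the word [j_k , … , j_1]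
πword : List ℕ → List ℕ → List ℕ → Maybe Filling → Maybe Filling
πword α β []      m = m
πword α β (j ∷ w) m with πword α β w m
... | nothing = nothing
... | just T  = πgen α β j T

EqOnSkew : List ℕ → List ℕ → Maybe Filling → Filling → Set
EqOnSkew α β nothing  T' = ⊥
EqOnSkew α β (just T) T' = ∀ c → c ∈ skewCells α β → T c ≡ T' c

-- Permutations of [n] as functions ℕ → ℕ (compared on [n])

Perm : Set
Perm = ℕ → ℕ

PermEq : ℕ → Perm → Perm → Set
PermEq n f g = ∀ k → 1 ≤ k → k ≤ n → f k ≡ g k

sgen : ℕ → Perm
sgen j x = if x ≡ᵇ j then suc j else (if x ≡ᵇ suc j then j else x)

wordPerm : List ℕ → Perm
wordPerm []      x = x
wordPerm (j ∷ w) x = sgen j (wordPerm w x)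

ValidWord : ℕ → List ℕ → Set
ValidWord n w = All (λ j → 1 ≤ j × j < n) w

ReducedWordOf : ℕ → Perm → List ℕ → Set
ReducedWordOf n σ w =
  ValidWord n w × PermEq n (wordPerm w) σ ×
  (∀ w' → ValidWord n w' → PermEq n (wordPerm w') σ → length w ≤ length w')

InSupp : ℕ → Perm → ℕ → Set
InSupp n σ i = ∃ λ w → ReducedWordOf n σ w × i ∈ w

colWord : List ℕ → List ℕ → Filling → List ℕ
colWord α β T = map T (skewCells α β)

nth : ℕ → List ℕ → ℕ
nth k       []       = 0
nth zero    (x ∷ xs) = x
nth (suc k) (x ∷ xs) = nth k xs

-- 0-based position of v (length if absent)
indexOf : ℕ → List ℕ → ℕ
indexOf v []       = 0
indexOf v (x ∷ xs) = if x ≡ᵇ v then 0 else suc (indexOf v xs)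

-- col_T in one-line notation: position k ↦ k-th letter
colPerm : List ℕ → List ℕ → Filling → Perm
colPerm α β T k = nth (k ∸ 1) (colWord α β T)

colPermInv : List ℕ → List ℕ → Filling → Perm
colPermInv α β T v = suc (indexOf v (colWord α β T))

colQuot : List ℕ → List ℕ → Filling → Filling → Perm
colQuot α β T₁ T₂ v = colPerm α β T₂ (colPermInv α β T₁ v)

Equiv : List ℕ → List ℕ → Filling → Filling → Set
Equiv α β T₁ T₂ = ∀ c c' → c ∈ skewCells α β → c' ∈ skewCells α β → col c ≡ col c' →
  (T₁ c < T₁ c' → T₂ c < T₂ c') × (T₂ c < T₂ c' → T₁ c < T₁ c')

Preceq : List ℕ → List ℕ → Filling → Filling → Set
Preceq α β T₁ T₂ = ∃ λ w → ReducedWordOf (size α β) (wordPerm w) w ×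
  EqOnSkew α β (πword α β w (just T₁)) T₂

count : {A : Set} → (A → Bool) → List A → ℕ
count p []       = 0
count p (x ∷ xs) = if p x then suc (count p xs) else count p xs

dropZeros : List ℕ → List ℕ
dropZeros []          = []
dropZeros (zero ∷ xs) = dropZeros xs
dropZeros (suc x ∷ xs) = suc x ∷ xs

-- the shape α^i of T^{>i}: the composition whose (bottom-aligned) diagram
-- consists of the cells of β together with the cells with entries > i
shapeAbove : List ℕ → List ℕ → Filling → ℕ → List ℕ
shapeAbove α β T i =
  dropZeros (map (λ r → count (λ c → inβᵇ α β (r , c) ∨ (inSkewᵇ α β (r , c) ∧ (i <ᵇ T (r , c))))
                               (oneTo (rowLen α r)))
                 (oneTo (length α)))

module Submission where

-- σ = col_{T₂} col_{T₁}⁻¹ sends the entry of each cell in T₁ to its entry in T₂, and every π_j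
-- acts on entries as the identity or as s_j, so σ is a product of simple transpositions.
-- A permutation has i in its support iff it does not map {1,…,i} onto itself: a reduced word
-- avoiding s_i preserves {1,…,i}; conversely every letter of a reduced word acts at an ascent
-- (reduced words have length the number of inversions), so the letter s_i sends positions
-- p < q to i + 1 and i, and the remaining letters keep each value on its side of i.
-- Finally σ preserves {1,…,i} iff each cell holds an entry > i in T₁ exactly when it does in
-- T₂. As rows of an SCT decrease, the cells of T^{>i} in each row form an initial segment of the
-- row, so this says precisely that T₁^{>i} and T₂^{>i} have the same shape.

open import Defs
open import Data.Nat using (ℕ; zero; suc; _+_; _∸_; _≤_; _<_; _≤ᵇ_; _<ᵇ_; _≡ᵇ_; z≤n; s≤s; pred)
open import Data.Nat.Properties
open import Data.Bool using (Bool; true; false; _∧_; _∨_)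
open import Data.Bool.Properties using (T-≡; ∧-conicalˡ; ∧-conicalʳ; ∧-zeroʳ)
open import Data.Unit using (⊤; tt)
open import Data.Empty using (⊥-elim)
open import Data.List using (List; []; _∷_; length; map)
open import Data.List.Properties using (length-map; map-cong-local; ∷-injectiveˡ; ∷-injectiveʳ)
open import Data.List.Relation.Unary.All using ([]; _∷_; tabulate)
open import Data.List.Relation.Unary.Any using (here; there; any?)
open import Data.List.Membership.Propositional using (_∈_)
open import Data.List.Membership.Propositional.Properties using (∈-map⁺; ∈-map⁻; ∈-concat⁺′; ∈-concat⁻′; ∈-upTo⁺; ∈-upTo⁻)
open import Data.Maybe using (just; nothing)
open import Data.Maybe.Properties using (just-injective)
open import Data.Product using (_×_; _,_; ∃; ∃₂; proj₁; proj₂)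
open import Data.Sum using (_⊎_; inj₁; inj₂)
open import Function using (_∘_)
open import Function.Bundles using (_⇔_; mk⇔; Equivalence)
open import Function.Construct.Composition using (_⇔-∘_)
open import Function.Construct.Symmetry using (⇔-sym)
open import Function.Related.TypeIsomorphisms using (¬-cong-⇔)
open import Relation.Nullary using (¬_; yes; no)
open import Relation.Binary using (tri<; tri≈; tri>)
open import Relation.Binary.PropositionalEquality

<⇒<ᵇ≡true : ∀ {m n} → m < n → (m <ᵇ n) ≡ true
<⇒<ᵇ≡true = Equivalence.to T-≡ ∘ <⇒<ᵇ

<ᵇ≡true⇒< : ∀ {m n} → (m <ᵇ n) ≡ true → m < n
<ᵇ≡true⇒< {m} {n} = <ᵇ⇒< m n ∘ Equivalence.from T-≡

≮⇒<ᵇ≡false : ∀ {m n} → ¬ m < n → (m <ᵇ n) ≡ false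
≮⇒<ᵇ≡false {m} {n} m≮n with m <ᵇ n in e
... | true  = ⊥-elim (m≮n (<ᵇ≡true⇒< e))
... | false = refl

<ᵇ≡false⇒≮ : ∀ {m n} → (m <ᵇ n) ≡ false → ¬ m < n
<ᵇ≡false⇒≮ e m<n with trans (sym (<⇒<ᵇ≡true m<n)) e
... | ()

≤⇒≤ᵇ≡true : ∀ {m n} → m ≤ n → (m ≤ᵇ n) ≡ true
≤⇒≤ᵇ≡true = Equivalence.to T-≡ ∘ ≤⇒≤ᵇ

≤ᵇ≡true⇒≤ : ∀ {m n} → (m ≤ᵇ n) ≡ true → m ≤ n
≤ᵇ≡true⇒≤ {m} {n} = ≤ᵇ⇒≤ m n ∘ Equivalence.from T-≡

≢⇒≡ᵇ≡false : ∀ {m n} → m ≢ n → (m ≡ᵇ n) ≡ false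
≢⇒≡ᵇ≡false {m} {n} m≢n with m ≡ᵇ n in e
... | true  = ⊥-elim (m≢n (≡ᵇ⇒≡ m n (Equivalence.from T-≡ e)))
... | false = refl

≡ᵇ-refl : ∀ n → (n ≡ᵇ n) ≡ true
≡ᵇ-refl n = Equivalence.to T-≡ (≡⇒≡ᵇ n n refl)

∧-true : ∀ {a b} → a ≡ true → b ≡ true → a ∧ b ≡ true
∧-true refl refl = refl

∨-true⁻ : ∀ a {b} → a ∨ b ≡ true → a ≡ true ⊎ b ≡ true
∨-true⁻ true  _ = inj₁ refl
∨-true⁻ false e = inj₂ e

∨-true⁺ : ∀ a {b} → (a ≡ false → b ≡ true) → a ∨ b ≡ true
∨-true⁺ true  _ = refl
∨-true⁺ false f = f refl

∧-congʳ-if : ∀ a {x y} → (a ≡ true → x ≡ y) → a ∧ x ≡ a ∧ y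
∧-congʳ-if true  f = f refl
∧-congʳ-if false _ = refl

<ᵇ-cong : ∀ {a b c d} → (a < b → c < d) → (c < d → a < b) → (a <ᵇ b) ≡ (c <ᵇ d)
<ᵇ-cong {a} {b} {c} {d} to from with a <ᵇ b in e₁ | c <ᵇ d in e₂
... | true  | true  = refl
... | false | false = refl
... | true  | false = ⊥-elim (<ᵇ≡false⇒≮ e₂ (to (<ᵇ≡true⇒< e₁)))
... | false | true  = ⊥-elim (<ᵇ≡false⇒≮ e₁ (from (<ᵇ≡true⇒< e₂)))

InRange : ℕ → ℕ → Set
InRange n x = 1 ≤ x × x ≤ n

sgen-at : ∀ j → sgen j j ≡ suc j
sgen-at j rewrite ≡ᵇ-refl j = refl

sgen-at-suc : ∀ j → sgen j (suc j) ≡ j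
sgen-at-suc j rewrite ≢⇒≡ᵇ≡false {suc j} {j} 1+n≢n | ≡ᵇ-refl j = refl

sgen-fixes : ∀ j x → x ≢ j → x ≢ suc j → sgen j x ≡ x
sgen-fixes j x x≢j x≢1+j rewrite ≢⇒≡ᵇ≡false x≢j | ≢⇒≡ᵇ≡false x≢1+j = refl

data SgenView (j x : ℕ) : ℕ → Set where
  at     : x ≡ j → SgenView j x (suc j)
  at-suc : x ≡ suc j → SgenView j x j
  fixed  : x ≢ j → x ≢ suc j → SgenView j x x

sgen-view : ∀ j x → SgenView j x (sgen j x)
sgen-view j x with x ≟ j
... | yes refl = subst (SgenView j x) (sym (sgen-at j)) (at refl)
... | no x≢j with x ≟ suc j
...   | yes refl = subst (SgenView j x) (sym (sgen-at-suc j)) (at-suc refl)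
...   | no x≢1+j = subst (SgenView j x) (sym (sgen-fixes j x x≢j x≢1+j)) (fixed x≢j x≢1+j)

sgen-involutive : ∀ j x → sgen j (sgen j x) ≡ x
sgen-involutive j x with sgen j x | sgen-view j x
... | _ | at refl         = sgen-at-suc j
... | _ | at-suc refl     = sgen-at j
... | _ | fixed x≢j x≢1+j = sgen-fixes j x x≢j x≢1+j

sgen-inRange : ∀ n j x → 1 ≤ j → j < n → InRange n x → InRange n (sgen j x)
sgen-inRange n j x 1≤j j<n x∈ with sgen j x | sgen-view j x
... | _ | at refl     = s≤s z≤n , j<n
... | _ | at-suc refl = 1≤j , ≤-trans (n≤1+n j) (proj₂ x∈)
... | _ | fixed _ _   = x∈

sgen-preserves-<ᵇ : ∀ j a b → ¬ (a ≡ j × b ≡ suc j) → ¬ (a ≡ suc j × b ≡ j) →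
                    (sgen j b <ᵇ sgen j a) ≡ (b <ᵇ a)
sgen-preserves-<ᵇ j a b ¬ab ¬ba with sgen j a | sgen-view j a | sgen j b | sgen-view j b
... | _ | at refl         | _ | at refl         = refl
... | _ | at refl         | _ | at-suc refl     = ⊥-elim (¬ab (refl , refl))
... | _ | at refl         | _ | fixed b≢j _     = <ᵇ-cong (λ h → ≤∧≢⇒< (≤-pred h) b≢j) m<n⇒m<1+n
... | _ | at-suc refl     | _ | at refl         = ⊥-elim (¬ba (refl , refl))
... | _ | at-suc refl     | _ | at-suc refl     = refl
... | _ | at-suc refl     | _ | fixed b≢j _     = <ᵇ-cong m<n⇒m<1+n (λ h → ≤∧≢⇒< (≤-pred h) b≢j)
... | _ | fixed _ a≢1+j   | _ | at refl         = <ᵇ-cong <⇒≤ (λ h → ≤∧≢⇒< h (a≢1+j ∘ sym))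
... | _ | fixed _ a≢1+j   | _ | at-suc refl     = <ᵇ-cong (λ h → ≤∧≢⇒< h (a≢1+j ∘ sym)) <⇒≤
... | _ | fixed _ _       | _ | fixed _ _       = refl

sgen-preserves-side : ∀ i j x → j ≢ i → (i <ᵇ sgen j x) ≡ (i <ᵇ x)
sgen-preserves-side i j x j≢i with sgen j x | sgen-view j x
... | _ | at refl     = <ᵇ-cong (λ h → ≤∧≢⇒< (≤-pred h) (j≢i ∘ sym)) m<n⇒m<1+n
... | _ | at-suc refl = <ᵇ-cong m<n⇒m<1+n (λ h → ≤∧≢⇒< (≤-pred h) (j≢i ∘ sym))
... | _ | fixed _ _   = refl

wordInv : List ℕ → Perm
wordInv []      x = x
wordInv (j ∷ w) x = wordInv w (sgen j x)

wordInv-wordPerm : ∀ w x → wordInv w (wordPerm w x) ≡ x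
wordInv-wordPerm []      x = refl
wordInv-wordPerm (j ∷ w) x rewrite sgen-involutive j (wordPerm w x) = wordInv-wordPerm w x

wordPerm-wordInv : ∀ w x → wordPerm w (wordInv w x) ≡ x
wordPerm-wordInv []      x = refl
wordPerm-wordInv (j ∷ w) x rewrite wordPerm-wordInv w (sgen j x) = sgen-involutive j x

wordInv-inRange : ∀ n w x → ValidWord n w → InRange n x → InRange n (wordInv w x)
wordInv-inRange n []      x _                   x∈ = x∈
wordInv-inRange n (j ∷ w) x ((1≤j , j<n) ∷ vw) x∈ = wordInv-inRange n w _ vw (sgen-inRange n j x 1≤j j<n x∈)

wordInv-injective-suc : ∀ w j → wordInv w j ≢ wordInv w (suc j)
wordInv-injective-suc w j e =
  1+n≢n (sym (trans (sym (wordPerm-wordInv w j)) (trans (cong (wordPerm w) e) (wordPerm-wordInv w (suc j)))))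

-- Inversions

sumTo : (ℕ → ℕ) → ℕ → ℕ
sumTo h zero    = 0
sumTo h (suc m) = sumTo h m + h (suc m)

inRange-suc : ∀ {m x} → InRange m x → InRange (suc m) x
inRange-suc (1≤x , x≤m) = 1≤x , m≤n⇒m≤1+n x≤m

sumTo-cong : ∀ {h h'} m → (∀ x → InRange m x → h x ≡ h' x) → sumTo h m ≡ sumTo h' m
sumTo-cong zero    eq = refl
sumTo-cong (suc m) eq = cong₂ _+_ (sumTo-cong m (λ x → eq x ∘ inRange-suc)) (eq (suc m) (s≤s z≤n , ≤-refl))

sumTo-zero : ∀ {h} m → (∀ x → InRange m x → h x ≡ 0) → sumTo h m ≡ 0
sumTo-zero {h} m eq = trans (sumTo-cong {h} {λ _ → 0} m eq) (sumTo-const-zero m)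
  where
  sumTo-const-zero : ∀ m → sumTo (λ _ → 0) m ≡ 0
  sumTo-const-zero zero    = refl
  sumTo-const-zero (suc m) = cong (_+ 0) (sumTo-const-zero m)

sumTo-suc-at : ∀ {h h'} m p → InRange m p → (∀ x → InRange m x → x ≢ p → h x ≡ h' x) →
               h' p ≡ suc (h p) → sumTo h' m ≡ suc (sumTo h m)
sumTo-suc-at zero (suc _) (_ , ()) _ _
sumTo-suc-at {h} {h'} (suc m) p (1≤p , p≤1+m) eq eqₚ with p ≟ suc m
... | yes refl = begin
  sumTo h' m + h' (suc m)     ≡⟨ cong₂ _+_ (sym (sumTo-cong m (λ x x∈ → eq x (inRange-suc x∈) (λ { refl → 1+n≰n (proj₂ x∈) })))) eqₚ ⟩
  sumTo h m + suc (h (suc m)) ≡⟨ +-suc (sumTo h m) _ ⟩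
  suc (sumTo h m + h (suc m)) ∎
  where open ≡-Reasoning
... | no p≢1+m = cong₂ _+_
  (sumTo-suc-at m p (1≤p , ≤-pred (≤∧≢⇒< p≤1+m p≢1+m)) (λ x → eq x ∘ inRange-suc) eqₚ)
  (sym (eq (suc m) (s≤s z≤n , ≤-refl) (p≢1+m ∘ sym)))

fromBool : Bool → ℕ
fromBool true  = 1
fromBool false = 0

inversionsAt : Perm → ℕ → ℕ
inversionsAt τ y = sumTo (λ x → fromBool (τ y <ᵇ τ x)) (pred y)

inversions : ℕ → Perm → ℕ
inversions n τ = sumTo (inversionsAt τ) n

below-pred⇒< : ∀ {x y} → InRange (pred y) x → x < y
below-pred⇒< {y = zero}  (s≤s z≤n , ())
below-pred⇒< {y = suc y} (_ , x≤y) = s≤s x≤y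

inversions-cong : ∀ n {τ τ'} → PermEq n τ τ' → inversions n τ ≡ inversions n τ'
inversions-cong n τ≗τ' = sumTo-cong n λ { y (1≤y , y≤n) → sumTo-cong (pred y) λ { x x∈ →
  cong fromBool (cong₂ _<ᵇ_ (τ≗τ' y 1≤y y≤n) (τ≗τ' x (proj₁ x∈) (<⇒≤ (<-≤-trans (below-pred⇒< x∈) y≤n)))) } }

inversions-id : ∀ n → inversions n (λ x → x) ≡ 0
inversions-id n = sumTo-zero n λ y _ → sumTo-zero (pred y) λ x x∈ →
  cong fromBool (≮⇒<ᵇ≡false (<-asym (below-pred⇒< x∈)))

inversions-ascent : ∀ n w j → ValidWord n w → 1 ≤ j → j < n → wordInv w j < wordInv w (suc j) →
                    inversions n (wordPerm (j ∷ w)) ≡ suc (inversions n (wordPerm w))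
inversions-ascent n w j vw 1≤j j<n p<q = sumTo-suc-at n q q∈ unchangedAt increasedAtq
  where
  τ = wordPerm w
  p = wordInv w j
  q = wordInv w (suc j)
  q∈ = wordInv-inRange n w (suc j) vw (s≤s z≤n , j<n)
  preimage : ∀ {x v} → τ x ≡ v → x ≡ wordInv w v
  preimage {x} e = trans (sym (wordInv-wordPerm w x)) (cong (wordInv w) e)
  unchangedAt : ∀ y → InRange n y → y ≢ q → inversionsAt τ y ≡ inversionsAt (wordPerm (j ∷ w)) y
  unchangedAt y (1≤y , _) y≢q = sumTo-cong (pred y) λ x x∈ → cong fromBool (sym (sgen-preserves-<ᵇ j (τ x) (τ y)
    (λ (_ , e) → y≢q (preimage e))
    (λ (e₁ , e₂) → <-asym p<q (subst₂ _<_ (preimage e₁) (preimage e₂) (below-pred⇒< x∈)))))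
  increasedAtq : inversionsAt (wordPerm (j ∷ w)) q ≡ suc (inversionsAt τ q)
  increasedAtq = sumTo-suc-at (pred q) p (proj₁ (wordInv-inRange n w j vw (1≤j , <⇒≤ j<n)) , <⇒≤pred p<q)
    (λ x _ x≢p → cong fromBool (sym (sgen-preserves-<ᵇ j (τ x) (τ q)
      (λ (e , _) → x≢p (preimage e))
      (λ (_ , e) → 1+n≢n (trans (sym (wordPerm-wordInv w (suc j))) e)))))
    atp
    where
    atp : fromBool (wordPerm (j ∷ w) q <ᵇ wordPerm (j ∷ w) p) ≡ suc (fromBool (τ q <ᵇ τ p))
    atp rewrite wordPerm-wordInv w j | wordPerm-wordInv w (suc j) | sgen-at j | sgen-at-suc j
              | <⇒<ᵇ≡true (n<1+n j) | ≮⇒<ᵇ≡false {suc j} {j} (<-asym (n<1+n j)) = refl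

inversions-descent : ∀ n w j → ValidWord n w → 1 ≤ j → j < n → wordInv w (suc j) < wordInv w j →
                     suc (inversions n (wordPerm (j ∷ w))) ≡ inversions n (wordPerm w)
inversions-descent n w j vw 1≤j j<n q<p = begin
  suc (inversions n (wordPerm (j ∷ w)))  ≡⟨ inversions-ascent n (j ∷ w) j ((1≤j , j<n) ∷ vw) 1≤j j<n ascent ⟨
  inversions n (wordPerm (j ∷ j ∷ w))    ≡⟨ inversions-cong n (λ x _ _ → sgen-involutive j (wordPerm w x)) ⟩
  inversions n (wordPerm w)              ∎
  where
  open ≡-Reasoning
  ascent : wordInv (j ∷ w) j < wordInv (j ∷ w) (suc j)
  ascent rewrite sgen-at j | sgen-at-suc j = q<p

inversions≤length : ∀ n w → ValidWord n w → inversions n (wordPerm w) ≤ length w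
inversions≤length n []      _ = ≤-reflexive (inversions-id n)
inversions≤length n (j ∷ w) ((1≤j , j<n) ∷ vw) with <-cmp (wordInv w j) (wordInv w (suc j))
... | tri< p<q _ _ = ≤-trans (≤-reflexive (inversions-ascent n w j vw 1≤j j<n p<q)) (s≤s (inversions≤length n w vw))
... | tri≈ _ p≡q _ = ⊥-elim (wordInv-injective-suc w j p≡q)
... | tri> _ _ q<p = m<n⇒m≤1+n (≤-trans (≤-reflexive (inversions-descent n w j vw 1≤j j<n q<p)) (inversions≤length n w vw))

AscentWord : List ℕ → Set
AscentWord []      = ⊤
AscentWord (j ∷ w) = wordInv w j < wordInv w (suc j) × AscentWord w

length≡inversions⇒ascentWord : ∀ n w → ValidWord n w → length w ≡ inversions n (wordPerm w) → AscentWord w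
length≡inversions⇒ascentWord n []      _ _ = tt
length≡inversions⇒ascentWord n (j ∷ w) ((1≤j , j<n) ∷ vw) len≡ with <-cmp (wordInv w j) (wordInv w (suc j))
... | tri< p<q _ _ = p<q , length≡inversions⇒ascentWord n w vw (suc-injective (trans len≡ (inversions-ascent n w j vw 1≤j j<n p<q)))
... | tri≈ _ p≡q _ = ⊥-elim (wordInv-injective-suc w j p≡q)
... | tri> _ _ q<p = ⊥-elim (1+n≰n (begin
  suc (length w)                          ≡⟨ len≡ ⟩
  inversions n (wordPerm (j ∷ w))         <⟨ n<1+n _ ⟩
  suc (inversions n (wordPerm (j ∷ w)))   ≡⟨ inversions-descent n w j vw 1≤j j<n q<p ⟩
  inversions n (wordPerm w)               ≤⟨ inversions≤length n w vw ⟩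
  length w                                ∎))
  where open ≤-Reasoning

descent-or-none : ∀ (ρ : Perm) m → (∃ λ j → 1 ≤ j × j < m × ρ (suc j) < ρ j) ⊎ (∀ j → 1 ≤ j → j < m → ¬ ρ (suc j) < ρ j)
descent-or-none ρ zero          = inj₂ λ _ _ ()
descent-or-none ρ (suc zero)    = inj₂ λ { (suc _) _ (s≤s ()) }
descent-or-none ρ (suc (suc m)) with descent-or-none ρ (suc m)
... | inj₁ (j , 1≤j , j<1+m , desc) = inj₁ (j , 1≤j , m<n⇒m<1+n j<1+m , desc)
... | inj₂ none with ρ (suc (suc m)) <? ρ (suc m)
...   | yes desc = inj₁ (suc m , s≤s z≤n , ≤-refl , desc)
...   | no ¬desc = inj₂ none′
  where
  none′ : ∀ j → 1 ≤ j → j < suc (suc m) → ¬ ρ (suc j) < ρ j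
  none′ j 1≤j j<2+m with j ≟ suc m
  ... | yes refl = ¬desc
  ... | no j≢1+m = none j 1≤j (≤∧≢⇒< (≤-pred j<2+m) j≢1+m)

strictlyIncreasing⇒id : ∀ n (ρ : Perm) → (∀ x → InRange n x → InRange n (ρ x)) →
                        (∀ j → 1 ≤ j → j < n → ρ j < ρ (suc j)) → ∀ x → InRange n x → ρ x ≡ x
strictlyIncreasing⇒id n ρ ρ∈ increasing x x∈@(1≤x , x≤n) = ≤-antisym ρx≤x (x≤ρx x x∈)
  where
  x≤ρx : ∀ x → InRange n x → x ≤ ρ x
  x≤ρx (suc zero)    1∈          = proj₁ (ρ∈ 1 1∈)
  x≤ρx (suc (suc x)) (_ , 2+x≤n) = <-≤-trans (s≤s (x≤ρx (suc x) (s≤s z≤n , <⇒≤ 2+x≤n))) (increasing (suc x) (s≤s z≤n) 2+x≤n)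
  gap : ∀ d → x + d ≤ n → ρ x + d ≤ ρ (x + d)
  gap zero    _   = ≤-reflexive (trans (+-identityʳ (ρ x)) (cong ρ (sym (+-identityʳ x))))
  gap (suc d) x+1+d≤n = begin
    ρ x + suc d       ≡⟨ +-suc (ρ x) d ⟩
    suc (ρ x + d)     ≤⟨ s≤s (gap d (≤-trans (+-monoʳ-≤ x (n≤1+n d)) x+1+d≤n)) ⟩
    suc (ρ (x + d))   ≤⟨ increasing (x + d) (≤-trans 1≤x (m≤m+n x d)) (subst (_≤ n) (+-suc x d) x+1+d≤n) ⟩
    ρ (suc (x + d))   ≡⟨ cong ρ (+-suc x d) ⟨
    ρ (x + suc d)     ∎
    where open ≤-Reasoning
  ρx≤x : ρ x ≤ x
  ρx≤x = +-cancelʳ-≤ (n ∸ x) (ρ x) x (begin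
    ρ x + (n ∸ x)     ≤⟨ gap (n ∸ x) (≤-reflexive (m+[n∸m]≡n x≤n)) ⟩
    ρ (x + (n ∸ x))   ≡⟨ cong ρ (m+[n∸m]≡n x≤n) ⟩
    ρ n               ≤⟨ proj₂ (ρ∈ n (≤-trans 1≤x x≤n , ≤-refl)) ⟩
    n                 ≡⟨ m+[n∸m]≡n x≤n ⟨
    x + (n ∸ x)       ∎)
    where open ≤-Reasoning

-- Bubble sort: cancel a descent of the inverse permutation while there is one.
wordOfLength-inversions : ∀ n k w → ValidWord n w → inversions n (wordPerm w) ≡ k →
                          ∃ λ u → ValidWord n u × PermEq n (wordPerm u) (wordPerm w) × length u ≡ k
wordOfLength-inversions n k w vw inv≡k with descent-or-none (wordInv w) n
... | inj₂ none = [] , [] , id≗τ , trans (sym (inversions-id n)) (trans (inversions-cong n id≗τ) inv≡k)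
  where
  τ⁻¹≗id : ∀ x → InRange n x → wordInv w x ≡ x
  τ⁻¹≗id = strictlyIncreasing⇒id n (wordInv w) (λ x → wordInv-inRange n w x vw)
    (λ j 1≤j j<n → ≤∧≢⇒< (≮⇒≥ (none j 1≤j j<n)) (wordInv-injective-suc w j))
  id≗τ : PermEq n (λ x → x) (wordPerm w)
  id≗τ x 1≤x x≤n = trans (sym (wordPerm-wordInv w x)) (cong (wordPerm w) (τ⁻¹≗id x (1≤x , x≤n)))
... | inj₁ (j , 1≤j , j<n , desc) with k | inversions-descent n w j vw 1≤j j<n desc
...   | zero   | 1+inv≡0 = ⊥-elim (1+n≢0 (trans 1+inv≡0 inv≡k))
...   | suc k′ | 1+inv≡inv with wordOfLength-inversions n k′ (j ∷ w) ((1≤j , j<n) ∷ vw) (suc-injective (trans 1+inv≡inv inv≡k))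
...     | u , vu , u≗sw , len≡ = j ∷ u , (1≤j , j<n) ∷ vu ,
          (λ x 1≤x x≤n → trans (cong (sgen j) (u≗sw x 1≤x x≤n)) (sgen-involutive j (wordPerm w x))) , cong suc len≡

reducedWord-exists : ∀ n w σ → ValidWord n w → PermEq n (wordPerm w) σ → ∃ (ReducedWordOf n σ)
reducedWord-exists n w σ vw w≗σ with wordOfLength-inversions n _ w vw refl
... | u , vu , u≗w , len≡ = u , vu , (λ x 1≤x x≤n → trans (u≗w x 1≤x x≤n) (w≗σ x 1≤x x≤n)) , minimal
  where
  minimal : ∀ w′ → ValidWord n w′ → PermEq n (wordPerm w′) σ → length u ≤ length w′
  minimal w′ vw′ w′≗σ = ≤-trans
    (≤-reflexive (trans len≡ (inversions-cong n (λ x 1≤x x≤n → trans (w≗σ x 1≤x x≤n) (sym (w′≗σ x 1≤x x≤n))))))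
    (inversions≤length n w′ vw′)

reduced⇒ascentWord : ∀ n σ w → ReducedWordOf n σ w → AscentWord w
reduced⇒ascentWord n σ w (vw , w≗σ , minimal) with wordOfLength-inversions n _ w vw refl
... | u , vu , u≗w , len≡ = length≡inversions⇒ascentWord n w vw (≤-antisym
  (≤-trans (minimal u vu (λ x 1≤x x≤n → trans (u≗w x 1≤x x≤n) (w≗σ x 1≤x x≤n))) (≤-reflexive len≡))
  (inversions≤length n w vw))

-- The support of a permutation

StabilisesPrefix : ℕ → Perm → ℕ → Set
StabilisesPrefix n σ i = ∀ v → 1 ≤ v → v ≤ n → (i <ᵇ σ v) ≡ (i <ᵇ v)

letterFree⇒stabilises : ∀ w i → ¬ i ∈ w → ∀ x → (i <ᵇ wordPerm w x) ≡ (i <ᵇ x)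
letterFree⇒stabilises []      i _   x = refl
letterFree⇒stabilises (j ∷ w) i i∉w x =
  trans (sgen-preserves-side i j (wordPerm w x) (i∉w ∘ here ∘ sym)) (letterFree⇒stabilises w i (i∉w ∘ there) x)

ascentWord-crosses : ∀ n w i → ValidWord n w → AscentWord w → i ∈ w →
                     ∃₂ λ p q → InRange n p × InRange n q × p < q ×
                                (i <ᵇ wordPerm w p) ≡ true × (i <ᵇ wordPerm w q) ≡ false
ascentWord-crosses n (j ∷ w) i ((1≤j , j<n) ∷ vw) (p<q , _) _ with j ≟ i
... | yes refl = wordInv w j , wordInv w (suc j) ,
      wordInv-inRange n w j vw (1≤j , <⇒≤ j<n) , wordInv-inRange n w (suc j) vw (s≤s z≤n , j<n) , p<q ,
      (begin
        (j <ᵇ sgen j (wordPerm w (wordInv w j)))        ≡⟨ cong (λ z → j <ᵇ sgen j z) (wordPerm-wordInv w j) ⟩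
        (j <ᵇ sgen j j)                                 ≡⟨ cong (j <ᵇ_) (sgen-at j) ⟩
        (j <ᵇ suc j)                                    ≡⟨ <⇒<ᵇ≡true (n<1+n j) ⟩
        true                                            ∎) ,
      (begin
        (j <ᵇ sgen j (wordPerm w (wordInv w (suc j))))  ≡⟨ cong (λ z → j <ᵇ sgen j z) (wordPerm-wordInv w (suc j)) ⟩
        (j <ᵇ sgen j (suc j))                           ≡⟨ cong (j <ᵇ_) (sgen-at-suc j) ⟩
        (j <ᵇ j)                                        ≡⟨ ≮⇒<ᵇ≡false (n≮n j) ⟩
        false                                           ∎)
  where open ≡-Reasoning
ascentWord-crosses n (j ∷ w) i _ _ (here i≡j) | no j≢i = ⊥-elim (j≢i (sym i≡j))
ascentWord-crosses n (j ∷ w) i (_ ∷ vw) (_ , asc) (there i∈w) | no j≢i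
  with ascentWord-crosses n w i vw asc i∈w
... | p , q , p∈ , q∈ , p<q , above , below = p , q , p∈ , q∈ , p<q ,
      trans (sgen-preserves-side i j (wordPerm w p) j≢i) above ,
      trans (sgen-preserves-side i j (wordPerm w q) j≢i) below

inSupp⇔¬stabilises : ∀ n w σ i → ValidWord n w → PermEq n (wordPerm w) σ →
                     InSupp n σ i ⇔ (¬ StabilisesPrefix n σ i)
inSupp⇔¬stabilises n w σ i vw w≗σ = mk⇔ inSupp⇒¬stabilises ¬stabilises⇒inSupp
  where
  inSupp⇒¬stabilises : InSupp n σ i → ¬ StabilisesPrefix n σ i
  inSupp⇒¬stabilises (u , red@(vu , u≗σ , _) , i∈u) stab
    with ascentWord-crosses n u i vu (reduced⇒ascentWord n σ u red) i∈u
  ... | p , q , (1≤p , p≤n) , (1≤q , q≤n) , p<q , above , below = i≮q (<-trans i<p p<q)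
    where
    i<p : i < p
    i<p = <ᵇ≡true⇒< (trans (sym (stab p 1≤p p≤n)) (trans (cong (i <ᵇ_) (sym (u≗σ p 1≤p p≤n))) above))
    i≮q : ¬ i < q
    i≮q = <ᵇ≡false⇒≮ (trans (sym (stab q 1≤q q≤n)) (trans (cong (i <ᵇ_) (sym (u≗σ q 1≤q q≤n))) below))
  ¬stabilises⇒inSupp : ¬ StabilisesPrefix n σ i → InSupp n σ i
  ¬stabilises⇒inSupp ¬stab with reducedWord-exists n w σ vw w≗σ
  ... | u , red@(_ , u≗σ , _) with any? (i ≟_) u
  ...   | yes i∈u = u , red , i∈u
  ...   | no  i∉u = ⊥-elim (¬stab λ v 1≤v v≤n →
                      trans (cong (i <ᵇ_) (sym (u≗σ v 1≤v v≤n))) (letterFree⇒stabilises u i i∉u v))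

∈-oneTo⁺ : ∀ {x m} → InRange m x → x ∈ oneTo m
∈-oneTo⁺ {suc x} (_ , x<m) = ∈-map⁺ suc (∈-upTo⁺ x<m)

∈-oneTo⁻ : ∀ {x m} → x ∈ oneTo m → InRange m x
∈-oneTo⁻ x∈ with ∈-map⁻ suc x∈
... | y , y∈ , refl = s≤s z≤n , ∈-upTo⁻ y∈

∈-filterᵇ'⁺ : ∀ {A : Set} (p : A → Bool) {x xs} → x ∈ xs → p x ≡ true → x ∈ filterᵇ' p xs
∈-filterᵇ'⁺ p {xs = y ∷ ys} (here refl) px rewrite px = here refl
∈-filterᵇ'⁺ p {xs = y ∷ ys} (there x∈) px with p y
... | true  = there (∈-filterᵇ'⁺ p x∈ px)
... | false = ∈-filterᵇ'⁺ p x∈ px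

∈-filterᵇ'⁻ : ∀ {A : Set} (p : A → Bool) {x} xs → x ∈ filterᵇ' p xs → p x ≡ true
∈-filterᵇ'⁻ p (y ∷ ys) x∈ with p y in py
∈-filterᵇ'⁻ p (y ∷ ys) (here refl) | true  = py
∈-filterᵇ'⁻ p (y ∷ ys) (there x∈)  | true  = ∈-filterᵇ'⁻ p ys x∈
∈-filterᵇ'⁻ p (y ∷ ys) x∈          | false = ∈-filterᵇ'⁻ p ys x∈

rowLen-nonempty⇒row∈ : ∀ α r → 1 ≤ rowLen α r → InRange (length α) r
rowLen-nonempty⇒row∈ (x ∷ xs) (suc zero)    _ = s≤s z≤n , s≤s z≤n
rowLen-nonempty⇒row∈ (x ∷ xs) (suc (suc r)) h = s≤s z≤n , s≤s (proj₂ (rowLen-nonempty⇒row∈ xs (suc r) h))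

rowLen≤maxPart : ∀ α r → rowLen α r ≤ maxPart α
rowLen≤maxPart []       r             = z≤n
rowLen≤maxPart (x ∷ xs) zero          = z≤n
rowLen≤maxPart (x ∷ xs) (suc zero)    = m≤m⊔n x (maxPart xs)
rowLen≤maxPart (x ∷ xs) (suc (suc r)) = ≤-trans (rowLen≤maxPart xs (suc r)) (m≤n⊔m x (maxPart xs))

inαᵇ⇒inRange : ∀ α r c → inαᵇ α (r , c) ≡ true → InRange (rowLen α r) c
inαᵇ⇒inRange α r c e = ≤ᵇ≡true⇒≤ (∧-conicalˡ _ _ e) , ≤ᵇ≡true⇒≤ (∧-conicalʳ _ _ e)

inRange⇒inαᵇ : ∀ α r c → InRange (rowLen α r) c → inαᵇ α (r , c) ≡ true
inRange⇒inαᵇ α r c (1≤c , c≤len) = ∧-true (≤⇒≤ᵇ≡true 1≤c) (≤⇒≤ᵇ≡true c≤len)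

inSkewᵇ-split : ∀ α β c → inSkewᵇ α β c ≡ true → inαᵇ α c ≡ true × inβᵇ α β c ≡ false
inSkewᵇ-split α β c e with inαᵇ α c | inβᵇ α β c
... | true | false = refl , refl

inβᵇ-leftClosed : ∀ α β r c c′ → inβᵇ α β (r , c′) ≡ true → 1 ≤ c → c ≤ c′ → inβᵇ α β (r , c) ≡ true
inβᵇ-leftClosed α β r c c′ e 1≤c c≤c′ =
  ∧-true (∧-conicalˡ (d <ᵇ r) _ e) (∧-true (≤⇒≤ᵇ≡true 1≤c) (≤⇒≤ᵇ≡true (≤-trans c≤c′ c′≤len)))
  where
  d = length α ∸ length β
  c′≤len : c′ ≤ rowLen β (r ∸ d)
  c′≤len = ≤ᵇ≡true⇒≤ (∧-conicalʳ (1 ≤ᵇ c′) _ (∧-conicalʳ (d <ᵇ r) _ e))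

∈skewCells⇒inSkewᵇ : ∀ α β c → c ∈ skewCells α β → inSkewᵇ α β c ≡ true
∈skewCells⇒inSkewᵇ α β c c∈ with ∈-concat⁻′ (map _ (oneTo (maxPart α))) c∈
... | _ , c∈column , column∈ with ∈-map⁻ _ column∈
...   | k , _ , refl = ∈-filterᵇ'⁻ (inSkewᵇ α β) (map (λ r → (r , k)) (oneTo (length α))) c∈column

inSkewᵇ⇒inRange : ∀ α β r c → inSkewᵇ α β (r , c) ≡ true → InRange (length α) r × InRange (rowLen α r) c
inSkewᵇ⇒inRange α β r c e = rowLen-nonempty⇒row∈ α r (≤-trans (proj₁ c∈) (proj₂ c∈)) , c∈
  where c∈ = inαᵇ⇒inRange α r c (proj₁ (inSkewᵇ-split α β (r , c) e))

inSkewᵇ⇒∈skewCells : ∀ α β r c → inSkewᵇ α β (r , c) ≡ true → (r , c) ∈ skewCells α β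
inSkewᵇ⇒∈skewCells α β r c e with inSkewᵇ⇒inRange α β r c e
... | r∈ , (1≤c , c≤len) =
  ∈-concat⁺′ (∈-filterᵇ'⁺ (inSkewᵇ α β) (∈-map⁺ (λ r → (r , c)) (∈-oneTo⁺ r∈)) e)
             (∈-map⁺ (λ c → filterᵇ' (inSkewᵇ α β) (map (λ r → (r , c)) (oneTo (length α))))
                     (∈-oneTo⁺ (1≤c , ≤-trans c≤len (rowLen≤maxPart α r))))

skewCell⇒inRange : ∀ α β r c → (r , c) ∈ skewCells α β → InRange (length α) r × InRange (rowLen α r) c
skewCell⇒inRange α β r c = inSkewᵇ⇒inRange α β r c ∘ ∈skewCells⇒inSkewᵇ α β (r , c)

inSkewᵇ-intro : ∀ α β c → inαᵇ α c ≡ true → inβᵇ α β c ≡ false → inSkewᵇ α β c ≡ true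
inSkewᵇ-intro α β c inα notInβ rewrite inα | notInβ = refl

count-mono : ∀ {A : Set} (p q : A → Bool) xs → (∀ x → x ∈ xs → q x ≡ true → p x ≡ true) → count q xs ≤ count p xs
count-mono p q []       q⇒p = z≤n
count-mono p q (y ∷ ys) q⇒p with q y in qy | p y in py | count-mono p q ys (λ x → q⇒p x ∘ there)
... | true  | true  | ih = s≤s ih
... | true  | false | _  with trans (sym (q⇒p y (here refl) qy)) py
...   | ()
count-mono p q (y ∷ ys) q⇒p | false | true  | ih = m≤n⇒m≤1+n ih
count-mono p q (y ∷ ys) q⇒p | false | false | ih = ih

count-cong : ∀ {A : Set} (p q : A → Bool) xs → (∀ x → x ∈ xs → p x ≡ q x) → count p xs ≡ count q xs
count-cong p q xs p≗q = ≤-antisym (count-mono q p xs λ x x∈ px → trans (sym (p≗q x x∈)) px)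
                                  (count-mono p q xs λ x x∈ qx → trans (p≗q x x∈) qx)

count-mono-< : ∀ {A : Set} (p q : A → Bool) xs x → (∀ x → x ∈ xs → q x ≡ true → p x ≡ true) → x ∈ xs →
               p x ≡ true → q x ≡ false → count q xs < count p xs
count-mono-< p q (y ∷ ys) x q⇒p (here refl) px qx rewrite px | qx = s≤s (count-mono p q ys (λ x → q⇒p x ∘ there))
count-mono-< p q (y ∷ ys) x q⇒p (there x∈) px qx with q y in qy | p y in py | count-mono-< p q ys x (λ x → q⇒p x ∘ there) x∈ px qx
... | true  | true  | ih = s≤s ih
... | true  | false | _  with trans (sym (q⇒p y (here refl) qy)) py
...   | ()
count-mono-< p q (y ∷ ys) x q⇒p (there x∈) px qx | false | true  | ih = m<n⇒m<1+n ih
count-mono-< p q (y ∷ ys) x q⇒p (there x∈) px qx | false | false | ih = ih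

length-dropZeros : ∀ xs → length (dropZeros xs) ≤ length xs
length-dropZeros []           = z≤n
length-dropZeros (zero ∷ xs)  = m≤n⇒m≤1+n (length-dropZeros xs)
length-dropZeros (suc x ∷ xs) = ≤-refl

dropZeros-injective : ∀ xs ys → length xs ≡ length ys → dropZeros xs ≡ dropZeros ys → xs ≡ ys
dropZeros-injective []           []           _     _ = refl
dropZeros-injective (zero ∷ xs)  (zero ∷ ys)  len≡ e = cong (zero ∷_) (dropZeros-injective xs ys (suc-injective len≡) e)
dropZeros-injective (zero ∷ xs)  (suc y ∷ ys) len≡ e = ⊥-elim (1+n≰n (begin
  suc (length ys)          ≡⟨ cong length e ⟨
  length (dropZeros xs)    ≤⟨ length-dropZeros xs ⟩
  length xs                ≡⟨ suc-injective len≡ ⟩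
  length ys                ∎))
  where open ≤-Reasoning
dropZeros-injective (suc x ∷ xs) (zero ∷ ys)  len≡ e = ⊥-elim (1+n≰n (begin
  suc (length xs)          ≡⟨ cong length e ⟩
  length (dropZeros ys)    ≤⟨ length-dropZeros ys ⟩
  length ys                ≡⟨ suc-injective len≡ ⟨
  length xs                ∎))
  where open ≤-Reasoning
dropZeros-injective (suc x ∷ xs) (suc y ∷ ys) _     e = e

map-≡⇒∈-≡ : ∀ {A B : Set} (f g : A → B) {x} xs → map f xs ≡ map g xs → x ∈ xs → f x ≡ g x
map-≡⇒∈-≡ f g (y ∷ ys) e (here refl) = ∷-injectiveˡ e
map-≡⇒∈-≡ f g (y ∷ ys) e (there x∈)  = map-≡⇒∈-≡ f g ys (∷-injectiveʳ e) x∈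

-- Shapes of the tableaux T^{>i}

inShapeAboveᵇ : List ℕ → List ℕ → Filling → ℕ → ℕ → ℕ → Bool
inShapeAboveᵇ α β T i r c = inβᵇ α β (r , c) ∨ (inSkewᵇ α β (r , c) ∧ (i <ᵇ T (r , c)))

rowCount : List ℕ → List ℕ → Filling → ℕ → ℕ → ℕ
rowCount α β T i r = count (inShapeAboveᵇ α β T i r) (oneTo (rowLen α r))

-- shapeAbove α β T i unfolds to dropZeros (rowCounts α β T i).
rowCounts : List ℕ → List ℕ → Filling → ℕ → List ℕ
rowCounts α β T i = map (rowCount α β T i) (oneTo (length α))

inShapeAboveᵇ-leftClosed : ∀ α β T i → SCT α β T → ∀ r c c′ → 1 ≤ c → c < c′ → c′ ≤ rowLen α r →
                           inShapeAboveᵇ α β T i r c′ ≡ true → inShapeAboveᵇ α β T i r c ≡ true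
inShapeAboveᵇ-leftClosed α β T i sct r c c′ 1≤c c<c′ c′≤len e = ∨-true⁺ (inβᵇ α β (r , c)) aboveIfNotInβ
  where
  aboveIfNotInβ : inβᵇ α β (r , c) ≡ false → inSkewᵇ α β (r , c) ∧ (i <ᵇ T (r , c)) ≡ true
  aboveIfNotInβ β-c with ∨-true⁻ (inβᵇ α β (r , c′)) e
  ... | inj₁ β-c′ with trans (sym (inβᵇ-leftClosed α β r c c′ β-c′ 1≤c (<⇒≤ c<c′))) β-c
  ...   | ()
  aboveIfNotInβ β-c | inj₂ e′ = ∧-true skew-c (<⇒<ᵇ≡true (<-trans (<ᵇ≡true⇒< (∧-conicalʳ _ _ e′)) decreasing))
    where
    skew-c = inSkewᵇ-intro α β (r , c) (inRange⇒inαᵇ α r c (1≤c , ≤-trans (<⇒≤ c<c′) c′≤len)) β-c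
    decreasing = SCT.rowsDec sct r c c′ (inSkewᵇ⇒∈skewCells α β r c skew-c)
                   (inSkewᵇ⇒∈skewCells α β r c′ (∧-conicalˡ _ _ e′)) c<c′

SameSide : List ℕ → List ℕ → Filling → Filling → ℕ → Set
SameSide α β T₁ T₂ i = ∀ c → c ∈ skewCells α β → (i <ᵇ T₁ c) ≡ (i <ᵇ T₂ c)

sameSide⇒shapeAbove≡ : ∀ α β T₁ T₂ i → SameSide α β T₁ T₂ i → shapeAbove α β T₂ i ≡ shapeAbove α β T₁ i
sameSide⇒shapeAbove≡ α β T₁ T₂ i same = cong dropZeros (map-cong-local {xs = oneTo (length α)} (tabulate λ {r} _ →
  count-cong _ _ (oneTo (rowLen α r)) λ c _ → cong (inβᵇ α β (r , c) ∨_) (∧-congʳ-if (inSkewᵇ α β (r , c)) λ skew →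
    sym (same (r , c) (inSkewᵇ⇒∈skewCells α β r c skew)))))

rowCount-< : ∀ α β T T′ i → SCT α β T → SCT α β T′ → ∀ r k → (r , k) ∈ skewCells α β →
             (i <ᵇ T (r , k)) ≡ true → (i <ᵇ T′ (r , k)) ≡ false → rowCount α β T′ i r < rowCount α β T i r
rowCount-< α β T T′ i sct sct′ r k rk∈ above below =
  count-mono-< (inShapeAboveᵇ α β T i r) (inShapeAboveᵇ α β T′ i r) (oneTo (rowLen α r)) k
    shape′⊆shape (∈-oneTo⁺ k∈) k∈shape k∉shape′
  where
  k∈ = proj₂ (skewCell⇒inRange α β r k rk∈)
  skew-k = ∈skewCells⇒inSkewᵇ α β (r , k) rk∈
  k∈shape : inShapeAboveᵇ α β T i r k ≡ true
  k∈shape = ∨-true⁺ (inβᵇ α β (r , k)) λ _ → ∧-true skew-k above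
  k∉shape′ : inShapeAboveᵇ α β T′ i r k ≡ false
  k∉shape′ rewrite proj₂ (inSkewᵇ-split α β (r , k) skew-k) | below = ∧-zeroʳ _
  shape′⊆shape : ∀ c → c ∈ oneTo (rowLen α r) → inShapeAboveᵇ α β T′ i r c ≡ true → inShapeAboveᵇ α β T i r c ≡ true
  shape′⊆shape c c∈ c∈shape′ with <-cmp c k
  ... | tri< c<k _ _ = inShapeAboveᵇ-leftClosed α β T i sct r c k (proj₁ (∈-oneTo⁻ c∈)) c<k (proj₂ k∈) k∈shape
  ... | tri≈ _ refl _ with trans (sym c∈shape′) k∉shape′
  ...   | ()
  shape′⊆shape c c∈ c∈shape′ | tri> _ _ k<c
    with trans (sym (inShapeAboveᵇ-leftClosed α β T′ i sct′ r k c (proj₁ k∈) k<c (proj₂ (∈-oneTo⁻ c∈)) c∈shape′)) k∉shape′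
  ... | ()

shapeAbove≡⇒rowCount≡ : ∀ α β T₁ T₂ i → shapeAbove α β T₂ i ≡ shapeAbove α β T₁ i →
                        ∀ r → InRange (length α) r → rowCount α β T₂ i r ≡ rowCount α β T₁ i r
shapeAbove≡⇒rowCount≡ α β T₁ T₂ i shape≡ r r∈ = map-≡⇒∈-≡ _ _ (oneTo (length α))
  (dropZeros-injective (rowCounts α β T₂ i) (rowCounts α β T₁ i)
    (trans (length-map _ (oneTo (length α))) (sym (length-map _ (oneTo (length α))))) shape≡)
  (∈-oneTo⁺ r∈)

shapeAbove≡⇒sameSide : ∀ α β T₁ T₂ i → SCT α β T₁ → SCT α β T₂ →
                       shapeAbove α β T₂ i ≡ shapeAbove α β T₁ i → SameSide α β T₁ T₂ i
shapeAbove≡⇒sameSide α β T₁ T₂ i sct₁ sct₂ shape≡ (r , k) rk∈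
  with i <ᵇ T₁ (r , k) in side₁ | i <ᵇ T₂ (r , k) in side₂
... | true  | true  = refl
... | false | false = refl
... | true  | false = ⊥-elim (<-irrefl rowCount≡ (rowCount-< α β T₁ T₂ i sct₁ sct₂ r k rk∈ side₁ side₂))
  where rowCount≡ = shapeAbove≡⇒rowCount≡ α β T₁ T₂ i shape≡ r (proj₁ (skewCell⇒inRange α β r k rk∈))
... | false | true  = ⊥-elim (<-irrefl (sym rowCount≡) (rowCount-< α β T₂ T₁ i sct₂ sct₁ r k rk∈ side₂ side₁))
  where rowCount≡ = shapeAbove≡⇒rowCount≡ α β T₁ T₂ i shape≡ r (proj₁ (skewCell⇒inRange α β r k rk∈))

-- The permutation col_{T₂} col_{T₁}⁻¹

nth-indexOf-map : ∀ (cells : List Cell) (T₁ T₂ : Filling) c → c ∈ cells →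
                  (∀ c′ → c′ ∈ cells → T₁ c′ ≡ T₁ c → c′ ≡ c) →
                  nth (indexOf (T₁ c) (map T₁ cells)) (map T₂ cells) ≡ T₂ c
nth-indexOf-map (c′ ∷ cells) T₁ T₂ c c∈ injective with T₁ c′ ≡ᵇ T₁ c in e
... | true = cong T₂ (injective c′ (here refl) (≡ᵇ⇒≡ _ _ (Equivalence.from T-≡ e)))
... | false with c∈
...   | here refl rewrite ≡ᵇ-refl (T₁ c′) with e
...     | ()
nth-indexOf-map (c′ ∷ cells) T₁ T₂ c c∈ injective | false | there c∈cells =
  nth-indexOf-map cells T₁ T₂ c c∈cells (λ c″ → injective c″ ∘ there)

colQuot-apply : ∀ α β T₁ T₂ → SCT α β T₁ → ∀ c → c ∈ skewCells α β → colQuot α β T₁ T₂ (T₁ c) ≡ T₂ c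
colQuot-apply α β T₁ T₂ sct₁ c c∈ =
  nth-indexOf-map (skewCells α β) T₁ T₂ c c∈ (λ c′ c′∈ → SCT.inj sct₁ c′ c c′∈ c∈)

sameSide⇔stabilises : ∀ α β T₁ T₂ i → SCT α β T₁ →
                      SameSide α β T₁ T₂ i ⇔ StabilisesPrefix (size α β) (colQuot α β T₁ T₂) i
sameSide⇔stabilises α β T₁ T₂ i sct₁ = mk⇔ sameSide⇒stabilises stabilises⇒sameSide
  where
  sameSide⇒stabilises : SameSide α β T₁ T₂ i → StabilisesPrefix (size α β) (colQuot α β T₁ T₂) i
  sameSide⇒stabilises same v 1≤v v≤n with SCT.surj sct₁ v 1≤v v≤n
  ... | c , c∈ , refl = trans (cong (i <ᵇ_) (colQuot-apply α β T₁ T₂ sct₁ c c∈)) (sym (same c c∈))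
  stabilises⇒sameSide : StabilisesPrefix (size α β) (colQuot α β T₁ T₂) i → SameSide α β T₁ T₂ i
  stabilises⇒sameSide stab c c∈ with SCT.range sct₁ c c∈
  ... | 1≤T₁c , T₁c≤n = trans (sym (stab (T₁ c) 1≤T₁c T₁c≤n)) (cong (i <ᵇ_) (colQuot-apply α β T₁ T₂ sct₁ c c∈))

stabilises⇔shapeAbove≡ : ∀ α β T₁ T₂ i → SCT α β T₁ → SCT α β T₂ →
                         StabilisesPrefix (size α β) (colQuot α β T₁ T₂) i ⇔ (shapeAbove α β T₂ i ≡ shapeAbove α β T₁ i)
stabilises⇔shapeAbove≡ α β T₁ T₂ i sct₁ sct₂ =
  mk⇔ (sameSide⇒shapeAbove≡ α β T₁ T₂ i) (shapeAbove≡⇒sameSide α β T₁ T₂ i sct₁ sct₂)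
    ⇔-∘ ⇔-sym (sameSide⇔stabilises α β T₁ T₂ i sct₁)

-- The 0-Hecke action

just-injective-≗ : ∀ {S T : Filling} → just S ≡ just T → ∀ x → T x ≡ S x
just-injective-≗ e x = cong (λ T → T x) (sym (just-injective e))

πgen-permutes : ∀ α β j T T′ → πgen α β j T ≡ just T′ → (∀ x → T′ x ≡ T x) ⊎ (∀ x → T′ x ≡ sgen j (T x))
πgen-permutes α β j T T′ e with locate (skewCells α β) T j | locate (skewCells α β) T (suc j)
... | nothing | _       = inj₁ (just-injective-≗ e)
... | just _  | nothing = inj₁ (just-injective-≗ e)
... | just c₁ | just c₂ with col c₁ ≤ᵇ col c₂ | attacksᵇ c₁ c₂
...   | false | _     = inj₁ (just-injective-≗ e)
...   | true  | false = inj₂ (just-injective-≗ e)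

πword-permutes : ∀ n α β w T T′ → ValidWord n w → πword α β w (just T) ≡ just T′ →
                 ∃ λ u → ValidWord n u × (∀ x → T′ x ≡ wordPerm u (T x))
πword-permutes n α β []      T T′ _          refl = [] , [] , (λ _ → refl)
πword-permutes n α β (j ∷ w) T T′ (vj ∷ vw) e with πword α β w (just T) in e₀
... | just T₀ with πword-permutes n α β w T T₀ vw e₀ | πgen-permutes α β j T₀ T′ e
...   | u , vu , T₀≗u | inj₁ T′≗T₀   = u , vu , (λ x → trans (T′≗T₀ x) (T₀≗u x))
...   | u , vu , T₀≗u | inj₂ T′≗sT₀ = j ∷ u , vj ∷ vu , (λ x → trans (T′≗sT₀ x) (cong (sgen j) (T₀≗u x)))

preceq⇒colQuot-wordPerm : ∀ α β T₁ T₂ → SCT α β T₁ → Preceq α β T₁ T₂ →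
                          ∃ λ u → ValidWord (size α β) u × PermEq (size α β) (wordPerm u) (colQuot α β T₁ T₂)
preceq⇒colQuot-wordPerm α β T₁ T₂ sct₁ (w , (vw , _) , πwT₁≗T₂) with πword α β w (just T₁) in e
... | just T′ with πword-permutes (size α β) α β w T₁ T′ vw e
...   | u , vu , T′≗uT₁ = u , vu , u≗σ
  where
  u≗σ : PermEq (size α β) (wordPerm u) (colQuot α β T₁ T₂)
  u≗σ v 1≤v v≤n with SCT.surj sct₁ v 1≤v v≤n
  ... | c , c∈ , refl = sym (trans (colQuot-apply α β T₁ T₂ sct₁ c c∈) (trans (sym (πwT₁≗T₂ c c∈)) (T′≗uT₁ c)))

proposition3p8 : (α β : List ℕ) → IsComposition α → IsComposition β → β ≤c α →
                 (n : ℕ) → n ≡ size α β →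
                 (i : ℕ) → 1 ≤ i → i < n →
                 (T₁ T₂ : Filling) → SCT α β T₁ → SCT α β T₂ →
                 Equiv α β T₁ T₂ → Preceq α β T₁ T₂ →
                 (InSupp n (colQuot α β T₁ T₂) i ⇔ (shapeAbove α β T₂ i ≢ shapeAbove α β T₁ i))
proposition3p8 α β _ _ _ .(size α β) refl i _ _ T₁ T₂ sct₁ sct₂ _ T₁⪯T₂
  with preceq⇒colQuot-wordPerm α β T₁ T₂ sct₁ T₁⪯T₂
... | u , vu , u≗σ =
  ¬-cong-⇔ (stabilises⇔shapeAbove≡ α β T₁ T₂ i sct₁ sct₂)
    ⇔-∘ inSupp⇔¬stabilises (size α β) u (colQuot α β T₁ T₂) i vu u≗σ
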